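{- Let $n\ge 3$ be a prime and let $G$ be the graph defined in the context below. For $l\in[n]$ let $P^l=\{v^l_{k,j}:k,j\in[n]\}$. Then for any distinct $s,t\in[n]$ and any $v\in P^s$, $v'\in P^t$, the vertices $v$ and $v'$ are adjacent in $G^2$.
   Context: For a graph $H$, $H^2$ denotes the square of $H$: the graph on $V(H)$ in which two distinct vertices are adjacent iff their distance in $H$ is at most $2$. Write $[n]=\{1,\dots,n\}$. For $i\in[n-1]$ define $L_i(j,k)\in[n]$ for $j,k\in[n]$ by $L_i(j,k)\equiv j+i(k-1)\pmod n$ (the residue $0$ being represented by $n$). The graph $G$ has vertex set consisting of: vertices $v^l_{k,j}$ for $k,l,j\in[n]$; vertices $w_{i,j}$ and $u_{i,j}$ for $i\in[n-1]$, $j\in[n]$; and vertices $s_m$ for $m\in[n]$ (all distinct). For $l,m\in[n]$ let $T_{l,m}=\{v^l_{1,m},v^l_{2,m},\dots,v^l_{n,m}\}$. The edges of $G$ are exactly: - $w_{i,j}v^l_{k,L_i(j,k)}$ for all $i\in[n-1]$, $j,k,l\in[n]$; - $u_{i,j}y$ for all $i\in[n-1]$, $j\in[n]$ and all $y\in T_{l,L_i(j,l)}$ for some $l\in[n]$; - $s_m y$ for all $m\in[n]$ and all $y\in T_{l,m}$ for some $l\in[n]$. -}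

module Defs where

open import Data.Nat using (ℕ; suc; _+_; _*_; _∸_)
open import Data.Fin using (Fin; toℕ)
open import Data.Integer as ℤ using (ℤ; +_)
open import Data.Integer.Divisibility using (_∣_)
open import Data.Product using (Σ; _×_)
open import Data.Sum using (_⊎_)
open import Relation.Binary.PropositionalEquality using (_≢_)

-- Convention: an index x ∈ [n] = {1,…,n} is represented by x : Fin n,
-- with value ⟦ x ⟧ = toℕ x + 1.  An index i ∈ [n-1] is i : Fin (n ∸ 1).
⟦_⟧ : ∀ {m} → Fin m → ℕ
⟦ x ⟧ = suc (toℕ x)

_≡_[mod_] : ℕ → ℕ → ℕ → Set
a ≡ b [mod n ] = (+ n) ∣ ((+ a) ℤ.- (+ b))

L≡ : (n : ℕ) → Fin (n ∸ 1) → Fin n → Fin n → Fin n → Set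
L≡ n i j k m = ⟦ m ⟧ ≡ ⟦ j ⟧ + ⟦ i ⟧ * (⟦ k ⟧ ∸ 1) [mod n ]

data Vertex (n : ℕ) : Set where
  v : (l k j : Fin n) → Vertex n
  w : (i : Fin (n ∸ 1)) (j : Fin n) → Vertex n
  u : (i : Fin (n ∸ 1)) (j : Fin n) → Vertex n
  s : (m : Fin n) → Vertex n

data Edge (n : ℕ) : Vertex n → Vertex n → Set where
  w-edge : ∀ i j k l m → L≡ n i j k m → Edge n (w i j) (v l k m)
  u-edge : ∀ i j k l m → L≡ n i j l m → Edge n (u i j) (v l k m)
  s-edge : ∀ m k l → Edge n (s m) (v l k m)

Adj : (n : ℕ) → Vertex n → Vertex n → Set
Adj n x y = Edge n x y ⊎ Edge n y x

Adj² : (n : ℕ) → Vertex n → Vertex n → Set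
Adj² n x y = x ≢ y × (Adj n x y ⊎ Σ (Vertex n) (λ z → Adj n x z × Adj n z y))

module Submission where

-- Vertices of distinct layers P^a, P^b have a common neighbour: s_j if j = j′, and otherwise
-- u_{i,J} for the line m = J + i(l - 1) of Z/n passing through (a, j) and (b, j′).
-- Its slope i ≡ (j - j′)(a - b)⁻¹ exists because n is prime, and is non-zero since j ≢ j′.

open import Defs
open import Data.Nat using (ℕ; _≤_)
open import Data.Nat.Primality using (Prime)
open import Data.Fin using (Fin)
open import Relation.Binary.PropositionalEquality using (_≢_)

open import Data.Nat as ℕ using (NonZero; _<_)
import Data.Nat.Properties as ℕ
import Data.Nat.Divisibility as ℕ
open import Data.Nat.DivMod using (m<n⇒m%n≡m)
open import Data.Nat.Coprimality using (Coprime; coprime-Bézout)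
open import Data.Nat.GCD using (module Bézout)
open import Data.Nat.Primality using (prime⇒irreducible; prime⇒nonZero)
open import Data.Integer as ℤ using (ℤ; +_; -[1+_]; 0ℤ; 1ℤ; _+_; _-_; _*_; -_)
import Data.Integer.Properties as ℤ
open import Data.Integer.Divisibility.Signed using (_∣_; divides; ∣⇒∣ᵤ; ∣ᵤ⇒∣; ∣m∣n⇒∣m+n; ∣m⇒∣-m; ∣n⇒∣m*n)
open import Data.Integer.DivMod using (_%ℕ_; _/ℕ_; a≡a%ℕn+[a/ℕn]*n; n%ℕd<d)
open import Data.Integer.Tactic.RingSolver using (solve-∀)
open import Data.Fin as Fin using (toℕ; fromℕ<; _≟_)
import Data.Fin.Properties as Fin
open import Data.Product as Σ using (Σ; _,_; _×_)
open import Data.Sum using (inj₁; inj₂)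
open import Function using (case_of_)
open import Level using (0ℓ)
open import Relation.Binary using (Setoid)
import Relation.Binary.Reasoning.Setoid as ≈-Reasoning
open import Relation.Binary.PropositionalEquality as ≡ using (_≡_; refl; cong)
open import Relation.Nullary using (¬_; yes; no; contradiction)

module Modulo (n : ℕ) where

  infix 4 _≈_
  record _≈_ (x y : ℤ) : Set where
    constructor congruent
    field n∣x-y : + n ∣ x - y

  ≈-reflexive : ∀ {x y} → x ≡ y → x ≈ y
  ≈-reflexive {x} refl = congruent (divides 0ℤ (≡.trans (ℤ.+-inverseʳ x) (≡.sym (ℤ.*-zeroˡ (+ n)))))

  ≈-sym : ∀ {x y} → x ≈ y → y ≈ x
  ≈-sym {x} {y} (congruent n∣x-y) = congruent (≡.subst (+ n ∣_) (swap x y) (∣m⇒∣-m n∣x-y))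
    where
    swap : ∀ x y → - (x - y) ≡ y - x
    swap = solve-∀

  ≈-trans : ∀ {x y z} → x ≈ y → y ≈ z → x ≈ z
  ≈-trans {x} {y} {z} (congruent n∣x-y) (congruent n∣y-z) =
    congruent (≡.subst (+ n ∣_) (telescope x y z) (∣m∣n⇒∣m+n n∣x-y n∣y-z))
    where
    telescope : ∀ x y z → (x - y) + (y - z) ≡ x - z
    telescope = solve-∀

  ≈-setoid : Setoid 0ℓ 0ℓ
  ≈-setoid = record
    { _≈_ = _≈_
    ; isEquivalence = record { refl = ≈-reflexive refl ; sym = ≈-sym ; trans = ≈-trans }
    }

  +-cong : ∀ {x y x′ y′} → x ≈ y → x′ ≈ y′ → x + x′ ≈ y + y′
  +-cong {x} {y} {x′} {y′} (congruent n∣x-y) (congruent n∣x′-y′) =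
    congruent (≡.subst (+ n ∣_) (regroup x y x′ y′) (∣m∣n⇒∣m+n n∣x-y n∣x′-y′))
    where
    regroup : ∀ x y x′ y′ → (x - y) + (x′ - y′) ≡ (x + x′) - (y + y′)
    regroup = solve-∀

  +-congˡ : ∀ c {x y} → x ≈ y → c + x ≈ c + y
  +-congˡ c = +-cong (≈-reflexive {c} refl)

  -‿cong : ∀ {x y} → x ≈ y → - x ≈ - y
  -‿cong {x} {y} (congruent n∣x-y) = congruent (≡.subst (+ n ∣_) (negate x y) (∣m⇒∣-m n∣x-y))
    where
    negate : ∀ x y → - (x - y) ≡ - x - - y
    negate = solve-∀

  *-congˡ : ∀ c {x y} → x ≈ y → c * x ≈ c * y
  *-congˡ c {x} {y} (congruent n∣x-y) = congruent (≡.subst (+ n ∣_) (distrib c x y) (∣n⇒∣m*n c n∣x-y))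
    where
    distrib : ∀ c x y → c * (x - y) ≡ c * x - c * y
    distrib = solve-∀

  *-congʳ : ∀ c {x y} → x ≈ y → x * c ≈ y * c
  *-congʳ c {x} {y} x≈y = ≡.subst₂ _≈_ (ℤ.*-comm c x) (ℤ.*-comm c y) (*-congˡ c x≈y)

  multiple≈0 : ∀ q → q * + n ≈ 0ℤ
  multiple≈0 q = congruent (divides q (ℤ.+-identityʳ (q * + n)))

  ≈⇒≡[mod] : ∀ {a b} → + a ≈ + b → a ≡ b [mod n ]
  ≈⇒≡[mod] (congruent n∣a-b) = ∣⇒∣ᵤ n∣a-b

  ∣⇒≈0 : ∀ {x} → + n ∣ x → x ≈ 0ℤ
  ∣⇒≈0 {x} n∣x = congruent (≡.subst (+ n ∣_) (≡.sym (ℤ.+-identityʳ x)) n∣x)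

  x-y≈0⇒x≈y : ∀ {x y} → x - y ≈ 0ℤ → x ≈ y
  x-y≈0⇒x≈y {x} {y} (congruent n∣x-y-0) = congruent (≡.subst (+ n ∣_) (ℤ.+-identityʳ (x - y)) n∣x-y-0)

  +-cancelˡ-≈ : ∀ c {x y} → c + x ≈ c + y → x ≈ y
  +-cancelˡ-≈ c {x} {y} c+x≈c+y =
    ≡.subst₂ _≈_ (cancel c x) (cancel c y) (+-congˡ (- c) c+x≈c+y)
    where
    cancel : ∀ c x → - c + (c + x) ≡ x
    cancel = solve-∀

  remainder≈ : .{{_ : NonZero n}} → ∀ x → + (x %ℕ n) ≈ x
  remainder≈ x = begin
    + (x %ℕ n)                        ≡⟨ ℤ.+-identityʳ _ ⟨
    + (x %ℕ n) + 0ℤ                   ≈⟨ +-congˡ (+ (x %ℕ n)) (≈-sym (multiple≈0 (x /ℕ n))) ⟩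
    + (x %ℕ n) + (x /ℕ n) * + n       ≡⟨ a≡a%ℕn+[a/ℕn]*n x n ⟨
    x                                 ∎
    where open ≈-Reasoning ≈-setoid

  -- ⟦ m ⟧ = toℕ m + 1 ranges over 1 … n, so the representative of x is 1 + ((x - 1) mod n).
  residue : .{{_ : NonZero n}} → ∀ x → Σ (Fin n) λ m → + ⟦ m ⟧ ≈ x
  residue x = fromℕ< (n%ℕd<d (x - 1ℤ) n) , (begin
    + ℕ.suc (toℕ (fromℕ< (n%ℕd<d (x - 1ℤ) n))) ≡⟨ cong (λ r → + ℕ.suc r) (Fin.toℕ-fromℕ< _) ⟩
    1ℤ + + ((x - 1ℤ) %ℕ n)                       ≈⟨ +-congˡ 1ℤ (remainder≈ (x - 1ℤ)) ⟩
    1ℤ + (x - 1ℤ)                                ≡⟨ shift x ⟩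
    x                                            ∎)
    where
    open ≈-Reasoning ≈-setoid
    shift : ∀ x → 1ℤ + (x - 1ℤ) ≡ x
    shift = solve-∀

  nonzero-residue : .{{_ : NonZero n}} → ∀ x → ¬ x ≈ 0ℤ → Σ (Fin (n ℕ.∸ 1)) λ i → + ⟦ i ⟧ ≈ x
  nonzero-residue x x≉0 with residue x
  ... | m , m≈x with toℕ m ℕ.<? n ℕ.∸ 1
  ...   | yes m<n-1 = fromℕ< m<n-1 , ≡.subst (λ r → + ℕ.suc r ≈ x) (≡.sym (Fin.toℕ-fromℕ< m<n-1)) m≈x
  ...   | no  m≮n-1 = contradiction (≈-trans (≈-sym m≈x) ⟦m⟧≈0) x≉0
    where
    ⟦m⟧≡n : ⟦ m ⟧ ≡ n
    ⟦m⟧≡n = ≡.trans (cong ℕ.suc (ℕ.≤-antisym (Fin.toℕ≤pred[n] m) (ℕ.≮⇒≥ m≮n-1))) (ℕ.suc-pred n)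
    ⟦m⟧≈0 : + ⟦ m ⟧ ≈ 0ℤ
    ⟦m⟧≈0 = ≡.subst (λ k → + k ≈ 0ℤ) (≡.sym ⟦m⟧≡n) (≡.subst (_≈ 0ℤ) (ℤ.*-identityˡ (+ n)) (multiple≈0 1ℤ))

  <-≈⇒≡ : .{{_ : NonZero n}} → ∀ {a b} → a < n → b < n → + a ≈ + b → a ≡ b
  <-≈⇒≡ {a} {b} a<n b<n (congruent n∣a-b) =
    ℤ.+-injective (ℤ.i-j≡0⇒i≡j (+ a) (+ b) (ℤ.∣i∣≡0⇒i≡0 distance≡0))
    where
    distance<n : ℤ.∣ + a - + b ∣ < n
    distance<n = ℕ.≤-<-trans
      (≡.subst (ℕ._≤ a ℕ.⊔ b) (cong ℤ.∣_∣ (≡.sym (ℤ.m-n≡m⊖n a b))) (ℤ.∣m⊝n∣≤m⊔n a b))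
      (ℕ.⊔-lub a<n b<n)
    distance≡0 : ℤ.∣ + a - + b ∣ ≡ 0
    distance≡0 = ≡.trans (≡.sym (m<n⇒m%n≡m distance<n)) (ℕ.n∣m⇒m%n≡0 _ n (∣⇒∣ᵤ n∣a-b))

  prime∤⇒coprime : Prime n → ∀ {d} → ¬ n ℕ.∣ d → Coprime d n
  prime∤⇒coprime n-prime n∤d (c∣d , c∣n) with prime⇒irreducible n-prime c∣n
  ... | inj₁ c≡1 = c≡1
  ... | inj₂ refl = contradiction c∣d n∤d

  pos-invertible : Prime n → ∀ d → ¬ n ℕ.∣ d → Σ ℤ λ X → X * + d ≈ 1ℤ
  pos-invertible n-prime d n∤d with coprime-Bézout (prime∤⇒coprime n-prime n∤d)
  ... | Bézout.+- x y 1+yn≡xd = + x , (begin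
    + x * + d             ≡⟨ ℤ.pos-* x d ⟨
    + (x ℕ.* d)           ≡⟨ cong +_ 1+yn≡xd ⟨
    + (1 ℕ.+ y ℕ.* n)     ≡⟨ cong (_+_ 1ℤ) (ℤ.pos-* y n) ⟩
    1ℤ + + y * + n        ≈⟨ +-congˡ 1ℤ (multiple≈0 (+ y)) ⟩
    1ℤ                    ∎)
    where open ≈-Reasoning ≈-setoid
  ... | Bézout.-+ x y 1+xd≡yn = - + x , (begin
    - + x * + d                   ≡⟨ negate-through-1 (+ x) (+ d) ⟩
    1ℤ + - (1ℤ + + x * + d)       ≡⟨ cong (λ t → 1ℤ + - t) (cong (_+_ 1ℤ) (ℤ.pos-* x d)) ⟨
    1ℤ + - + (1 ℕ.+ x ℕ.* d)      ≡⟨ cong (λ t → 1ℤ + - + t) 1+xd≡yn ⟩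
    1ℤ + - + (y ℕ.* n)            ≡⟨ cong (λ t → 1ℤ + - t) (ℤ.pos-* y n) ⟩
    1ℤ + - (+ y * + n)            ≡⟨ cong (_+_ 1ℤ) (ℤ.neg-distribˡ-* (+ y) (+ n)) ⟩
    1ℤ + - + y * + n              ≈⟨ +-congˡ 1ℤ (multiple≈0 (- + y)) ⟩
    1ℤ                            ∎)
    where
    open ≈-Reasoning ≈-setoid
    negate-through-1 : ∀ a b → - a * b ≡ 1ℤ + - (1ℤ + a * b)
    negate-through-1 = solve-∀

  invertible : Prime n → ∀ D → ¬ D ≈ 0ℤ → Σ ℤ λ X → X * D ≈ 1ℤ
  invertible n-prime D D≉0 = fix-sign D (pos-invertible n-prime ℤ.∣ D ∣ (λ n∣∣D∣ → D≉0 (∣⇒≈0 (∣ᵤ⇒∣ n∣∣D∣))))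
    where
    fix-sign : ∀ D → Σ ℤ (λ X → X * + ℤ.∣ D ∣ ≈ 1ℤ) → Σ ℤ λ X → X * D ≈ 1ℤ
    fix-sign (+ d) inverse = inverse
    fix-sign -[1+ d ] (X , X*d≈1) = - X , ≡.subst (_≈ 1ℤ) (neg*neg X (+ ℕ.suc d)) X*d≈1
      where
      neg*neg : ∀ X Y → X * Y ≡ - X * - Y
      neg*neg = solve-∀

  record Line (A Y B Y′ : ℤ) : Set where
    constructor line
    field
      slope intercept : ℤ
      slope≉0 : ¬ slope ≈ 0ℤ
      through₁ : Y ≈ intercept + slope * A
      through₂ : Y′ ≈ intercept + slope * B

  line-through : Prime n → ∀ {A B Y Y′} → ¬ A ≈ B → ¬ Y ≈ Y′ → Line A Y B Y′
  line-through n-prime {A} {B} {Y} {Y′} A≉B Y≉Y′ = line I J I≉0 on-A on-B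
    where
    open ≈-Reasoning ≈-setoid
    D : ℤ
    D = A - B
    inverse : Σ ℤ λ X → X * D ≈ 1ℤ
    inverse = invertible n-prime D (λ D≈0 → A≉B (x-y≈0⇒x≈y D≈0))
    X : ℤ
    X = Σ.proj₁ inverse
    I J : ℤ
    I = (Y - Y′) * X
    J = Y - I * A
    I*D≈Y-Y′ : I * D ≈ Y - Y′
    I*D≈Y-Y′ = begin
      I * D                  ≡⟨ ℤ.*-assoc (Y - Y′) X D ⟩
      (Y - Y′) * (X * D)     ≈⟨ *-congˡ (Y - Y′) (Σ.proj₂ inverse) ⟩
      (Y - Y′) * 1ℤ          ≡⟨ ℤ.*-identityʳ (Y - Y′) ⟩
      Y - Y′                 ∎
    I≉0 : ¬ I ≈ 0ℤ
    I≉0 I≈0 = Y≉Y′ (x-y≈0⇒x≈y (begin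
      Y - Y′   ≈⟨ I*D≈Y-Y′ ⟨
      I * D    ≈⟨ *-congʳ D I≈0 ⟩
      0ℤ * D   ≡⟨ ℤ.*-zeroˡ D ⟩
      0ℤ       ∎))
    on-A : Y ≈ J + I * A
    on-A = ≈-reflexive (≡.sym (restore Y (I * A)))
      where
      restore : ∀ y t → (y - t) + t ≡ y
      restore = solve-∀
    on-B : Y′ ≈ J + I * B
    on-B = begin
      Y′               ≡⟨ subtract Y Y′ ⟩
      Y - (Y - Y′)     ≈⟨ +-congˡ Y (-‿cong I*D≈Y-Y′) ⟨
      Y - I * D        ≡⟨ split Y I A B ⟩
      J + I * B        ∎
      where
      subtract : ∀ y y′ → y′ ≡ y - (y - y′)
      subtract = solve-∀
      split : ∀ y i a b → y - i * (a - b) ≡ (y - i * a) + i * b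
      split = solve-∀

module _ {n : ℕ} (n-prime : Prime n) where
  open Modulo n

  private instance
    n≢0 : NonZero n
    n≢0 = prime⇒nonZero n-prime

  L≡-intro : ∀ i J k m → + ⟦ m ⟧ ≈ + ⟦ J ⟧ + + ⟦ i ⟧ * + toℕ k → L≡ n i J k m
  L≡-intro i J k m m≈J+ik = ≈⇒≡[mod] (≡.subst (+ ⟦ m ⟧ ≈_) (≡.sym pos-affine) m≈J+ik)
    where
    pos-affine : + (⟦ J ⟧ ℕ.+ ⟦ i ⟧ ℕ.* toℕ k) ≡ + ⟦ J ⟧ + + ⟦ i ⟧ * + toℕ k
    pos-affine = ≡.trans (ℤ.pos-+ ⟦ J ⟧ _) (cong (_+_ (+ ⟦ J ⟧)) (ℤ.pos-* ⟦ i ⟧ (toℕ k)))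

  toℕ-≈⇒≡ : ∀ {x y : Fin n} → + toℕ x ≈ + toℕ y → x ≡ y
  toℕ-≈⇒≡ {x} {y} x≈y = Fin.toℕ-injective (<-≈⇒≡ (Fin.toℕ<n x) (Fin.toℕ<n y) x≈y)

  -- u_{i,J} is a common neighbour of every v^a_{k,j} and v^b_{k′,j′}.
  GridLine : Fin n → Fin n → Fin n → Fin n → Set
  GridLine a j b j′ = Σ (Fin (n ℕ.∸ 1)) λ i → Σ (Fin n) λ J → L≡ n i J a j × L≡ n i J b j′

  line-through-points : ∀ {a b} → a ≢ b → ∀ {j j′} → j ≢ j′ → GridLine a j b j′
  line-through-points {a} {b} a≢b {j} {j′} j≢j′ = on-grid (line-through n-prime a≉b j≉j′)
    where
    a≉b : ¬ + toℕ a ≈ + toℕ b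
    a≉b a≈b = a≢b (toℕ-≈⇒≡ a≈b)
    j≉j′ : ¬ + ⟦ j ⟧ ≈ + ⟦ j′ ⟧
    j≉j′ j≈j′ = j≢j′ (toℕ-≈⇒≡ (+-cancelˡ-≈ 1ℤ j≈j′))
    on-grid : Line (+ toℕ a) (+ ⟦ j ⟧) (+ toℕ b) (+ ⟦ j′ ⟧) → GridLine a j b j′
    on-grid (line I J′ I≉0 through-a through-b) =
      i , J , L≡-intro i J a j (represent through-a) , L≡-intro i J b j′ (represent through-b)
      where
      i : Fin (n ℕ.∸ 1)
      i = Σ.proj₁ (nonzero-residue I I≉0)
      J : Fin n
      J = Σ.proj₁ (residue J′)
      represent : ∀ {Y X} → Y ≈ J′ + I * X → Y ≈ + ⟦ J ⟧ + + ⟦ i ⟧ * X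
      represent {X = X} Y≈J′+IX = ≈-trans Y≈J′+IX
        (+-cong (≈-sym (Σ.proj₂ (residue J′))) (*-congʳ X (≈-sym (Σ.proj₂ (nonzero-residue I I≉0)))))

  common-neighbour : ∀ {a b} → a ≢ b → ∀ k j k′ j′ →
    Σ (Vertex n) λ z → Adj n (v a k j) z × Adj n z (v b k′ j′)
  common-neighbour {a} {b} a≢b k j k′ j′ with j ≟ j′
  ... | yes refl = s j , inj₂ (s-edge j k a) , inj₁ (s-edge j k′ b)
  ... | no j≢j′ = case line-through-points a≢b j≢j′ of λ where
    (i , J , through-a , through-b) →
      u i J , inj₂ (u-edge i J k a j through-a) , inj₁ (u-edge i J k′ b j′ through-b)

lemma2p5 : (n : ℕ) → 3 ≤ n → Prime n →
    (a b : Fin n) → a ≢ b →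
    (k j k′ j′ : Fin n) → Adj² n (v a k j) (v b k′ j′)
lemma2p5 n _ n-prime a b a≢b k j k′ j′ =
  (λ { refl → a≢b refl }) , inj₂ (common-neighbour n-prime a≢b k j k′ j′)
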